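{- Let $(G,\beta)$ be an edge-labeled graph (in the setting described in the context) with vertices $v_1,\dots,v_n$, and let $(G_{red},\beta_{red})$ be the reduced graph associated to the vertex $v_n$. Then the map $\psi:\hat R_G\to\hat R_{G_{red}}$, $\psi(f_{v_1},\dots,f_{v_{n-1}},f_{v_n})=(f_{v_1},\dots,f_{v_{n-1}})$, is a surjective $\mathbb{Z}$-module homomorphism whose kernel is $\hat{\mathcal F}_n\cup\{(0,\dots,0)\}$, a submodule of rank $1$.
   Context: Setting: $G$ is a finite connected simple graph. Each vertex $v$ is labeled by $M_v=m_v\mathbb{Z}$ ($m_v\in\mathbb{Z}$), each edge $e$ by $\mathbb{Z}/r_e\mathbb{Z}$ ($r_e\in\mathbb{Z}$). A spline is $f\in\prod_v M_v$ with $f_u-f_v\in r_e\mathbb{Z}$ for every edge $e=uv$; $\hat R_G$ is the $\mathbb{Z}$-module of splines. An $i$-th flow-up class is a spline $F$ with $f_{v_i}\neq0$ and $f_{v_s}=0$ for all $s<i$; $\hat{\mathcal F}_i$ is the set of these. $(a,b,\dots)$ denotes gcd and $[a,b,\dots]$ lcm. Reduced graph associated to a vertex $v$: (1) delete $v$ and its incident edges; each neighbor $w$ of $v$ is kept with vertex module replaced by $[m_w,(m_v,r_{vw})]\mathbb{Z}$; for each pair of distinct neighbors $w,w'$ of $v$ add an edge $ww'$ labeled $(r_{vw},r_{vw'})$; (2) replace any set of parallel edges with labels $r_1,\dots,r_k$ by a single edge labeled $[r_1,\dots,r_k]$. The rank of a $\mathbb{Z}$-module is the size of a minimum generating set. 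-}

module Defs where

open import Data.Nat using (ℕ; zero; suc; _<_)
open import Data.Integer using (ℤ; 0ℤ; _+_; _-_; _*_)
open import Data.Integer.Divisibility using (_∣_)
open import Data.Integer.GCD using (gcd)
open import Data.Integer.LCM using (lcm)
open import Data.Fin using (Fin; zero; suc; inject₁; fromℕ; _≟_)
open import Data.Bool using (Bool; true; false; _∧_; _∨_; not; if_then_else_)
open import Data.Product using (Σ; _×_; _,_; ∃)
open import Data.Sum using (_⊎_)
open import Relation.Binary.PropositionalEquality using (_≡_; _≢_)
open import Relation.Nullary using (¬_; does)

-- Edge-labeled graphs on the vertex set Fin n (vertex v_i is  i-1 : Fin n).
-- adj u v = true  iff  uv is an edge.
-- m v     : the vertex module is  m v ℤ.
-- r u v   : label of the edge uv is  ℤ / (r u v) ℤ  (only meaningful on edges).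

record EdgeLabeledGraph (n : ℕ) : Set where
  field
    adj : Fin n → Fin n → Bool
    m   : Fin n → ℤ
    r   : Fin n → Fin n → ℤ
open EdgeLabeledGraph public

IsSimple : ∀ {n} → EdgeLabeledGraph n → Set
IsSimple G =
  (∀ u v → adj G u v ≡ adj G v u) ×
  (∀ v → adj G v v ≡ false) ×
  (∀ u v → adj G u v ≡ true → r G u v ≡ r G v u)

data Reach {n : ℕ} (G : EdgeLabeledGraph n) : Fin n → Fin n → Set where
  here : ∀ {u} → Reach G u u
  step : ∀ {u v w} → adj G u v ≡ true → Reach G v w → Reach G u w

IsConnected : ∀ {n} → EdgeLabeledGraph n → Set
IsConnected G = ∀ u v → Reach G u v

NonzeroLabels : ∀ {n} → EdgeLabeledGraph n → Set
NonzeroLabels G =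
  (∀ v → m G v ≢ 0ℤ) × (∀ u v → adj G u v ≡ true → r G u v ≢ 0ℤ)

IsSpline : ∀ {n} → EdgeLabeledGraph n → (Fin n → ℤ) → Set
IsSpline G f =
  (∀ v → m G v ∣ f v) ×
  (∀ u v → adj G u v ≡ true → r G u v ∣ (f u - f v))

IsFlowUp : ∀ {n} → EdgeLabeledGraph n → Fin n → (Fin n → ℤ) → Set
IsFlowUp {n} G i f =
  IsSpline G f × f i ≢ 0ℤ × (∀ (s : Fin n) → Data.Fin._<_ s i → f s ≡ 0ℤ)

module _ {k : ℕ} (G : EdgeLabeledGraph (suc k)) where
  private
    vn : Fin (suc k)
    vn = fromℕ k
    i : Fin k → Fin (suc k)
    i = inject₁

  nb : Fin k → Bool
  nb w = adj G (i w) vn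

  newEdge : Fin k → Fin k → Bool
  newEdge u w = nb u ∧ nb w ∧ not (does (u ≟ w))

  oldEdge : Fin k → Fin k → Bool
  oldEdge u w = adj G (i u) (i w)

  reducedGraph : EdgeLabeledGraph k
  reducedGraph = record
    { adj = λ u w → oldEdge u w ∨ newEdge u w
    ; m   = λ w → if nb w then lcm (m G (i w)) (gcd (m G vn) (r G (i w) vn))
                          else m G (i w)
    -- step (2): parallel edges (old edge and new edge) merged with lcm
    ; r   = λ u w → if oldEdge u w
                      then (if newEdge u w
                              then lcm (r G (i u) (i w)) (gcd (r G vn (i u)) (r G vn (i w)))
                              else r G (i u) (i w))
                      else gcd (r G vn (i u)) (r G vn (i w))
    }

  ψ : (Fin (suc k) → ℤ) → (Fin k → ℤ)
  ψ f w = f (inject₁ w)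

zeroV : ∀ {n} → Fin n → ℤ
zeroV _ = 0ℤ

_+V_ : ∀ {n} → (Fin n → ℤ) → (Fin n → ℤ) → Fin n → ℤ
(f +V g) v = f v + g v

_·V_ : ∀ {n} → ℤ → (Fin n → ℤ) → Fin n → ℤ
(c ·V f) v = c * f v

_≐_ : ∀ {n} → (Fin n → ℤ) → (Fin n → ℤ) → Set
f ≐ g = ∀ v → f v ≡ g v

linComb : ∀ {n l} → (Fin l → ℤ) → (Fin l → Fin n → ℤ) → Fin n → ℤ
linComb {l = zero}  c gs = zeroV
linComb {l = suc l} c gs = (c zero ·V gs zero) +V linComb (λ j → c (suc j)) (λ j → gs (suc j))

IsSubmodule : ∀ {n} → ((Fin n → ℤ) → Set) → Set
IsSubmodule {n} P =
  P zeroV ×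
  (∀ f g → P f → P g → P (f +V g)) ×
  (∀ c f → P f → P (c ·V f)) ×
  (∀ f g → f ≐ g → P f → P g)

GeneratedBy : ∀ {n l} → ((Fin n → ℤ) → Set) → (Fin l → Fin n → ℤ) → Set
GeneratedBy {n} {l} P gs =
  (∀ j → P (gs j)) ×
  (∀ f → P f → Σ (Fin l → ℤ) λ c → f ≐ linComb c gs)

HasRank : ∀ {n} → ((Fin n → ℤ) → Set) → ℕ → Set
HasRank {n} P l =
  (Σ (Fin l → Fin n → ℤ) λ gs → GeneratedBy P gs) ×
  (∀ l' → l' < l → ¬ (Σ (Fin l' → Fin n → ℤ) λ gs → GeneratedBy P gs))

module Submission where

-- Deleting vₙ loses only the conditions at vₙ: a neighbour w of vₙ satisfies
-- f w ≡ f vₙ ≡ 0 modulo gcd (m vₙ) (r w vₙ), and two neighbours u, w agree modulo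
-- gcd (r u vₙ) (r w vₙ), which is what the reduced labels record; so ψ lands in the
-- splines of G_red. Conversely, extending a spline g of G_red to vₙ means solving
-- x ≡ 0 mod m vₙ and x ≡ g w mod r w vₙ for every neighbour w. These are exactly the
-- pairwise compatible systems of the Chinese remainder theorem for non-coprime moduli,
-- which is proved by merging two congruences at a time (Bézout) and carrying the
-- compatibility along with gcd (lcm a b) c ∣ lcm (gcd a c) (gcd b c). The kernel
-- consists of the splines vanishing off vₙ, whose value at vₙ is any multiple of
-- L = lcm of m vₙ and the r w vₙ; with nonzero labels L ≠ 0, so the kernel is free of rank 1.

open import Defs
open import Data.Nat using (ℕ; suc)
open import Data.Integer using (ℤ; 0ℤ)
open import Data.Fin using (Fin; fromℕ)
open import Data.Product using (Σ; _×_)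
open import Data.Sum using (_⊎_)
open import Function.Bundles using (_⇔_)

open import Data.Product using (_,_)
open import Data.Sum using (inj₁; [_,_]′)
open import Relation.Binary.PropositionalEquality

module ℕ-GcdLcm where
  open import Data.Nat using (zero; _*_; NonZero; ≢-nonZero)
  open import Data.Nat.Properties using (*-comm; *-assoc; *-zeroʳ; m*n≡0⇒m≡0∨n≡0)
  open import Data.Nat.Divisibility
  open import Data.Nat.DivMod using (_/_; m/n*n≡m; m*[n/m]≡n)
  open import Data.Nat.GCD
  open import Data.Nat.LCM
  open import Data.Nat.Coprimality using (coprime-/gcd; coprime-factors)
  open ∣-Reasoning

  ∣x*b⇒∣x*u : ∀ x {d b u} → d ∣ x * b → gcd d b ∣ u → d ∣ x * u
  ∣x*b⇒∣x*u x {d} {b} {u} d∣xb gcd∣u = begin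
    d                     ∣⟨ gcd-greatest (n∣m*n x) d∣xb ⟩
    gcd (x * d) (x * b)   ≡⟨ c*gcd[m,n]≡gcd[cm,cn] x d b ⟨
    x * gcd d b           ∣⟨ *-monoʳ-∣ x gcd∣u ⟩
    x * u                 ∎

  -- With g = gcd a b, a = a′ g and b = b′ g, lcm a b = a′ b = b′ a gives d ∣ a′ u and
  -- d ∣ b′ u, and a′, b′ are coprime.
  ∣lcm⇒∣ : ∀ {a b d u} → d ∣ lcm a b → gcd d a ∣ u → gcd d b ∣ u → d ∣ u
  ∣lcm⇒∣ {zero} {b} {d} {u} _ gcd[d,a]∣u _ = subst (_∣ u) (gcd-identityʳ d) gcd[d,a]∣u
  ∣lcm⇒∣ {a@(suc _)} {b} {d} {u} d∣lcm gcd[d,a]∣u gcd[d,b]∣u =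
    coprime-factors (coprime-/gcd a b)
      (∣x*b⇒∣x*u a′ d∣a′b gcd[d,b]∣u , ∣x*b⇒∣x*u b′ d∣b′a gcd[d,a]∣u)
    where
    instance _ : NonZero (gcd a b)
             _ = ≢-nonZero (gcd[m,n]≢0 a b (inj₁ λ ()))
    a′ b′ : ℕ
    a′ = a / gcd a b
    b′ = b / gcd a b
    d∣b′a : d ∣ b′ * a
    d∣b′a = subst (d ∣_) (*-comm a b′) d∣lcm
    d∣a′b : d ∣ a′ * b
    d∣a′b = subst (d ∣_) (begin-equality
      a * b′                ≡⟨ cong (_* b′) (m/n*n≡m (gcd[m,n]∣m a b)) ⟨
      a′ * gcd a b * b′     ≡⟨ *-assoc a′ (gcd a b) b′ ⟩
      a′ * (gcd a b * b′)   ≡⟨ cong (a′ *_) (m*[n/m]≡n (gcd[m,n]∣n a b)) ⟩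
      a′ * b                ∎) d∣lcm

  gcd[lcm[a,b],c]∣lcm[gcd[a,c],gcd[b,c]] : ∀ a b c →
    gcd (lcm a b) c ∣ lcm (gcd a c) (gcd b c)
  gcd[lcm[a,b],c]∣lcm[gcd[a,c],gcd[b,c]] a b c =
    ∣lcm⇒∣ (gcd[m,n]∣m (lcm a b) c)
      (∣-trans (through a) (m∣lcm[m,n] (gcd a c) (gcd b c)))
      (∣-trans (through b) (n∣lcm[m,n] (gcd a c) (gcd b c)))
    where
    through : ∀ x → gcd (gcd (lcm a b) c) x ∣ gcd x c
    through x = gcd-greatest (gcd[m,n]∣n (gcd (lcm a b) c) x)
      (∣-trans (gcd[m,n]∣m (gcd (lcm a b) c) x) (gcd[m,n]∣n (lcm a b) c))

  lcm≢0 : ∀ {a b} → a ≢ 0 → b ≢ 0 → lcm a b ≢ 0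
  lcm≢0 {a} {b} a≢0 b≢0 lcm≡0 = [ a≢0 , b≢0 ]′ (m*n≡0⇒m≡0∨n≡0 a (begin-equality
    a * b               ≡⟨ gcd*lcm a b ⟨
    gcd a b * lcm a b   ≡⟨ cong (gcd a b *_) lcm≡0 ⟩
    gcd a b * 0         ≡⟨ *-zeroʳ (gcd a b) ⟩
    0                   ∎))

open import Data.Nat using (zero)
import Data.Nat as Nat
import Data.Nat.Properties as ℕₚ
import Data.Nat.GCD as NatGCD
open import Data.Integer using (1ℤ; -1ℤ; +_; _+_; _-_; _*_; -_; ∣_∣)
import Data.Integer.Properties as ℤ
open import Data.Integer.Divisibility.Signed
  using (_∣_; divides; ∣ᵤ⇒∣; ∣⇒∣ᵤ; ∣-refl; ∣-trans; ∣m∣n⇒∣m+n; ∣m⇒∣-m; ∣n⇒∣m*n)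
open import Data.Integer.GCD using (gcd)
import Data.Integer.GCD as GCD
open import Data.Integer.LCM using (lcm)
import Data.Integer.LCM as LCM
open import Data.Integer.Tactic.RingSolver using (solve-∀)
open import Data.Product using (∃; ∃₂; proj₁; proj₂)
open import Data.Sum using (inj₂)
open import Data.Fin using (zero; suc; inject₁; toℕ; _<_; _≟_)
import Data.Fin.Properties as Finₚ
open import Data.Fin.Relation.Unary.Top using (view; ‵fromℕ; ‵inject₁)
open import Data.Vec.Functional using (foldr)
open import Data.Bool using (true; false; _∨_; if_then_else_)
open import Data.Bool.Properties using (∨-zeroˡ; ∨-zeroʳ)
open import Data.Empty using (⊥-elim)
open import Function using (_∘_)
open import Function.Bundles using (mk⇔)
open import Relation.Nullary using (¬_; yes; no)
open ≡-Reasoning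

-- IsSpline uses the unsigned divisibility (on absolute values); we work with the signed
-- one, whose indices are not hidden under ∣_∣ and can therefore be inferred.
∣0 : ∀ d → d ∣ 0ℤ
∣0 d = divides 0ℤ (sym (ℤ.*-zeroˡ d))

1∣ : ∀ i → 1ℤ ∣ i
1∣ i = divides i (sym (ℤ.*-identityʳ i))

gcd∣ˡ : ∀ i j → gcd i j ∣ i
gcd∣ˡ i j = ∣ᵤ⇒∣ (GCD.gcd[i,j]∣i i j)

gcd∣ʳ : ∀ i j → gcd i j ∣ j
gcd∣ʳ i j = ∣ᵤ⇒∣ (GCD.gcd[i,j]∣j i j)

∣lcmˡ : ∀ i j → i ∣ lcm i j
∣lcmˡ i j = ∣ᵤ⇒∣ (LCM.i∣lcm[i,j] i j)

∣lcmʳ : ∀ i j → j ∣ lcm i j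
∣lcmʳ i j = ∣ᵤ⇒∣ (LCM.j∣lcm[i,j] i j)

lcm-least : ∀ {i j k} → i ∣ k → j ∣ k → lcm i j ∣ k
lcm-least {i} {j} {k} i∣k j∣k = ∣ᵤ⇒∣ (LCM.lcm-least {i} {j} {k} (∣⇒∣ᵤ i∣k) (∣⇒∣ᵤ j∣k))

gcd[lcm[i,j],k]∣lcm[gcd[i,k],gcd[j,k]] : ∀ i j k → gcd (lcm i j) k ∣ lcm (gcd i k) (gcd j k)
gcd[lcm[i,j],k]∣lcm[gcd[i,k],gcd[j,k]] i j k =
  ∣ᵤ⇒∣ (ℕ-GcdLcm.gcd[lcm[a,b],c]∣lcm[gcd[a,c],gcd[b,c]] (∣ i ∣) (∣ j ∣) (∣ k ∣))

lcm≢0 : ∀ {i j} → i ≢ 0ℤ → j ≢ 0ℤ → lcm i j ≢ 0ℤ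
lcm≢0 i≢0 j≢0 lcm≡0 =
  ℕ-GcdLcm.lcm≢0 (i≢0 ∘ ℤ.∣i∣≡0⇒i≡0) (j≢0 ∘ ℤ.∣i∣≡0⇒i≡0) (ℤ.+-injective lcm≡0)

-- A record rather than a synonym for n ∣ x - y, so that x, y and n can be inferred.
infix 4 _≡_mod_
record _≡_mod_ (x y n : ℤ) : Set where
  constructor mk≡mod
  field ∣-difference : n ∣ x - y
open _≡_mod_ public

mod-refl : ∀ {n} x → x ≡ x mod n
mod-refl {n} x = mk≡mod (subst (n ∣_) (sym (ℤ.+-inverseʳ x)) (∣0 n))

mod-sym : ∀ {n x y} → x ≡ y mod n → y ≡ x mod n
mod-sym {n} {x} {y} (mk≡mod n∣x-y) = mk≡mod (subst (n ∣_) (negate x y) (∣m⇒∣-m n∣x-y))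
  where
  negate : ∀ x y → - (x - y) ≡ y - x
  negate = solve-∀

mod-trans : ∀ {n x y z} → x ≡ y mod n → y ≡ z mod n → x ≡ z mod n
mod-trans {n} {x} {y} {z} (mk≡mod n∣x-y) (mk≡mod n∣y-z) =
  mk≡mod (subst (n ∣_) (telescope x y z) (∣m∣n⇒∣m+n n∣x-y n∣y-z))
  where
  telescope : ∀ x y z → (x - y) + (y - z) ≡ x - z
  telescope = solve-∀

mod-+ : ∀ {n x y x′ y′} → x ≡ y mod n → x′ ≡ y′ mod n → x + x′ ≡ y + y′ mod n
mod-+ {n} {x} {y} {x′} {y′} (mk≡mod n∣x-y) (mk≡mod n∣x′-y′) =
  mk≡mod (subst (n ∣_) (interchange x y x′ y′) (∣m∣n⇒∣m+n n∣x-y n∣x′-y′))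
  where
  interchange : ∀ x y x′ y′ → (x - y) + (x′ - y′) ≡ (x + x′) - (y + y′)
  interchange = solve-∀

mod-* : ∀ {n x y} c → x ≡ y mod n → c * x ≡ c * y mod n
mod-* {n} {x} {y} c (mk≡mod n∣x-y) = mk≡mod (subst (n ∣_) (distrib c x y) (∣n⇒∣m*n c n∣x-y))
  where
  distrib : ∀ c x y → c * (x - y) ≡ c * x - c * y
  distrib = solve-∀

mod-1 : ∀ x y → x ≡ y mod 1ℤ
mod-1 x y = mk≡mod (1∣ (x - y))

mod-weaken : ∀ {d n x y} → d ∣ n → x ≡ y mod n → x ≡ y mod d
mod-weaken d∣n (mk≡mod n∣x-y) = mk≡mod (∣-trans d∣n n∣x-y)

mod-lcm : ∀ {i j x y} → x ≡ y mod i → x ≡ y mod j → x ≡ y mod lcm i j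
mod-lcm (mk≡mod i∣x-y) (mk≡mod j∣x-y) = mk≡mod (lcm-least i∣x-y j∣x-y)

mod-trans-gcd : ∀ j {i x y z} → x ≡ y mod i → y ≡ z mod gcd i j → x ≡ z mod gcd i j
mod-trans-gcd j {i} x≡y = mod-trans (mod-weaken (gcd∣ˡ i j) x≡y)

mod-gcd-lcm : ∀ i j k {x y} → x ≡ y mod gcd i k → x ≡ y mod gcd j k → x ≡ y mod gcd (lcm i j) k
mod-gcd-lcm i j k x≡y x≡y′ =
  mod-weaken (gcd[lcm[i,j],k]∣lcm[gcd[i,k],gcd[j,k]] i j k) (mod-lcm x≡y x≡y′)

∣⇒≡0-mod : ∀ {n x} → n ∣ x → x ≡ 0ℤ mod n
∣⇒≡0-mod {n} {x} n∣x = mk≡mod (subst (n ∣_) (sym (ℤ.+-identityʳ x)) n∣x)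

≡0-mod⇒∣ : ∀ {n x} → x ≡ 0ℤ mod n → n ∣ x
≡0-mod⇒∣ {n} {x} (mk≡mod n∣x-0) = subst (n ∣_) (ℤ.+-identityʳ x) n∣x-0

+∣i∣≡±i : ∀ i → ∃ λ ε → + ∣ i ∣ ≡ ε * i
+∣i∣≡±i i with ℤ.+∣i∣≡i⊎+∣i∣≡-i i
... | inj₁ eq = 1ℤ , trans eq (sym (ℤ.*-identityˡ i))
... | inj₂ eq = -1ℤ , trans eq (sym (ℤ.-1*i≡-i i))

private
  identity⇒combination : ∀ {d a b x y} → d Nat.+ y Nat.* b ≡ x Nat.* a →
    + d ≡ + x * + a + - + y * + b
  identity⇒combination {d} {a} {b} {x} {y} eq = begin
    + d                               ≡⟨ cancel (+ d) (+ y) (+ b) ⟩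
    (+ d + + y * + b) + - + y * + b   ≡⟨ cong (_+ - + y * + b) (begin
      + d + + y * + b                   ≡⟨ cong (λ z → + d + z) (ℤ.pos-* y b) ⟨
      + d + + (y Nat.* b)               ≡⟨ ℤ.pos-+ d (y Nat.* b) ⟨
      + (d Nat.+ y Nat.* b)             ≡⟨ cong +_ eq ⟩
      + (x Nat.* a)                     ≡⟨ ℤ.pos-* x a ⟩
      + x * + a                         ∎) ⟩
    + x * + a + - + y * + b           ∎
    where
    cancel : ∀ p q r → p ≡ (p + q * r) + - q * r
    cancel = solve-∀

bézout-ℕ : ∀ m n → ∃₂ λ s t → + NatGCD.gcd m n ≡ s * + m + t * + n
bézout-ℕ m n with NatGCD.Bézout.identity (NatGCD.gcd-GCD m n)
... | NatGCD.Bézout.+- x y eq = + x , - + y , identity⇒combination {a = m} {n} {x} {y} eq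
... | NatGCD.Bézout.-+ x y eq = - + x , + y ,
  trans (identity⇒combination {a = n} {m} {y} {x} eq) (ℤ.+-comm (+ y * + n) (- + x * + m))

bézout : ∀ i j → ∃₂ λ s t → gcd i j ≡ s * i + t * j
bézout i j with bézout-ℕ ∣ i ∣ ∣ j ∣ | +∣i∣≡±i i | +∣i∣≡±i j
... | s , t , eq | εᵢ , +∣i∣≡ | εⱼ , +∣j∣≡ = s * εᵢ , t * εⱼ , (begin
  gcd i j                       ≡⟨ eq ⟩
  s * + ∣ i ∣ + t * + ∣ j ∣     ≡⟨ cong₂ (λ p q → s * p + t * q) +∣i∣≡ +∣j∣≡ ⟩
  s * (εᵢ * i) + t * (εⱼ * j)   ≡⟨ cong₂ _+_ (ℤ.*-assoc s εᵢ i) (ℤ.*-assoc t εⱼ j) ⟨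
  s * εᵢ * i + t * εⱼ * j       ∎)

crt₂ : ∀ i j {x₁ x₂} → x₁ ≡ x₂ mod gcd i j → ∃ λ x → x ≡ x₁ mod i × x ≡ x₂ mod j
crt₂ i j {x₁} {x₂} (mk≡mod (divides q x₁-x₂≡q·gcd)) with bézout i j
... | s , t , gcd≡ = x₁ - q * s * i ,
  mk≡mod (divides (- (q * s)) (shift x₁ (q * s) i)) ,
  mk≡mod (divides (q * t) (begin
    x₁ - q * s * i - x₂               ≡⟨ swap x₁ x₂ (q * s * i) ⟩
    (x₁ - x₂) - q * s * i             ≡⟨ cong (_- q * s * i) (trans x₁-x₂≡q·gcd (cong (q *_) gcd≡)) ⟩
    q * (s * i + t * j) - q * s * i   ≡⟨ cancel q s i t j ⟩
    q * t * j                         ∎))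
  where
  shift : ∀ x c i → x - c * i - x ≡ - c * i
  shift = solve-∀
  swap : ∀ x y z → x - z - y ≡ (x - y) - z
  swap = solve-∀
  cancel : ∀ q s i t j → q * (s * i + t * j) - q * s * i ≡ q * t * j
  cancel = solve-∀

crt : ∀ {n} (m₀ x₀ : ℤ) (m x : Fin n → ℤ) →
      (∀ i → x₀ ≡ x i mod gcd m₀ (m i)) →
      (∀ i j → x i ≡ x j mod gcd (m i) (m j)) →
      ∃ λ y → y ≡ x₀ mod m₀ × (∀ i → y ≡ x i mod m i)
crt {zero}  m₀ x₀ m x _ _ = x₀ , mod-refl x₀ , λ ()
crt {suc n} m₀ x₀ m x compat₀ compat = y ,
  mod-trans (mod-weaken (∣lcmˡ m₀ (m zero)) y≡y′) y′≡x₀ ,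
  λ { zero    → mod-trans (mod-weaken (∣lcmʳ m₀ (m zero)) y≡y′) y′≡x[0]
    ; (suc i) → y≡x[1+i] i }
  where
  merged : ∃ λ y′ → y′ ≡ x₀ mod m₀ × y′ ≡ x zero mod m zero
  merged = crt₂ m₀ (m zero) (compat₀ zero)
  y′ : ℤ
  y′ = proj₁ merged
  y′≡x₀ : y′ ≡ x₀ mod m₀
  y′≡x₀ = proj₁ (proj₂ merged)
  y′≡x[0] : y′ ≡ x zero mod m zero
  y′≡x[0] = proj₂ (proj₂ merged)
  rest : ∃ λ y → y ≡ y′ mod lcm m₀ (m zero) × (∀ i → y ≡ x (suc i) mod m (suc i))
  rest = crt (lcm m₀ (m zero)) y′ (m ∘ suc) (x ∘ suc)
    (λ i → mod-gcd-lcm m₀ (m zero) (m (suc i))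
      (mod-trans-gcd (m (suc i)) y′≡x₀ (compat₀ (suc i)))
      (mod-trans-gcd (m (suc i)) y′≡x[0] (compat zero (suc i))))
    (λ i j → compat (suc i) (suc j))
  y : ℤ
  y = proj₁ rest
  y≡y′ : y ≡ y′ mod lcm m₀ (m zero)
  y≡y′ = proj₁ (proj₂ rest)
  y≡x[1+i] : ∀ i → y ≡ x (suc i) mod m (suc i)
  y≡x[1+i] = proj₂ (proj₂ rest)

lcmᶠ : ∀ {n} → (Fin n → ℤ) → ℤ
lcmᶠ = foldr lcm 1ℤ

∣lcmᶠ : ∀ {n} (m : Fin n → ℤ) i → m i ∣ lcmᶠ m
∣lcmᶠ m zero    = ∣lcmˡ (m zero) (lcmᶠ (m ∘ suc))
∣lcmᶠ m (suc i) = ∣-trans (∣lcmᶠ (m ∘ suc) i) (∣lcmʳ (m zero) (lcmᶠ (m ∘ suc)))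

lcmᶠ-least : ∀ {n} {m : Fin n → ℤ} {z} → (∀ i → m i ∣ z) → lcmᶠ m ∣ z
lcmᶠ-least {zero}  {z = z} _ = 1∣ z
lcmᶠ-least {suc n} m∣z = lcm-least (m∣z zero) (lcmᶠ-least (m∣z ∘ suc))

lcmᶠ≢0 : ∀ {n} {m : Fin n → ℤ} → (∀ i → m i ≢ 0ℤ) → lcmᶠ m ≢ 0ℤ
lcmᶠ≢0 {zero}  _ ()
lcmᶠ≢0 {suc n} m≢0 = lcm≢0 (m≢0 zero) (lcmᶠ≢0 (m≢0 ∘ suc))

infixl 5 _∷ʳ_
_∷ʳ_ : ∀ {n} {A : Set} → (Fin n → A) → A → Fin (suc n) → A
_∷ʳ_ {zero}  g x _       = x
_∷ʳ_ {suc n} g x zero    = g zero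
_∷ʳ_ {suc n} g x (suc i) = (g ∘ suc ∷ʳ x) i

∷ʳ-fromℕ : ∀ {n} {A : Set} (g : Fin n → A) x → (g ∷ʳ x) (fromℕ n) ≡ x
∷ʳ-fromℕ {zero}  g x = refl
∷ʳ-fromℕ {suc n} g x = ∷ʳ-fromℕ (g ∘ suc) x

∷ʳ-inject₁ : ∀ {n} {A : Set} (g : Fin n → A) x i → (g ∷ʳ x) (inject₁ i) ≡ g i
∷ʳ-inject₁ {suc n} g x zero    = refl
∷ʳ-inject₁ {suc n} g x (suc i) = ∷ʳ-inject₁ (g ∘ suc) x i

≐-by-last : ∀ {n} {f g : Fin (suc n) → ℤ} →
  (∀ i → f (inject₁ i) ≡ g (inject₁ i)) → f (fromℕ n) ≡ g (fromℕ n) → f ≐ g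
≐-by-last f≐g fₙ≡gₙ v with view v
... | ‵fromℕ     = fₙ≡gₙ
... | ‵inject₁ i = f≐g i

inject₁<fromℕ : ∀ {n} (i : Fin n) → inject₁ i < fromℕ n
inject₁<fromℕ {n} i =
  subst (λ m → toℕ (inject₁ i) Nat.< m) (sym (Finₚ.toℕ-fromℕ n)) (Finₚ.inject₁ℕ< i)

below-fromℕ : ∀ {n} {P : Fin (suc n) → Set} → (∀ i → P (inject₁ i)) → ∀ s → s < fromℕ n → P s
below-fromℕ P[i] s s<n with view s
... | ‵fromℕ     = ⊥-elim (ℕₚ.<-irrefl refl s<n)
... | ‵inject₁ i = P[i] i

cyclic⇒hasRank1 : ∀ {n} {P : (Fin n → ℤ) → Set} {e : Fin n → ℤ} v →
  P e → (∀ f → P f → ∃ λ q → f ≐ (q ·V e)) → e v ≢ 0ℤ → HasRank P 1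
cyclic⇒hasRank1 {n} {P} {e} v Pe cyclic eᵥ≢0 = ((λ _ → e) , (λ _ → Pe) , span) , minimal
  where
  span : ∀ f → P f → Σ (Fin 1 → ℤ) λ c → f ≐ linComb c (λ _ → e)
  span f Pf = (λ _ → proj₁ (cyclic f Pf)) ,
              λ u → trans (proj₂ (cyclic f Pf) u) (sym (ℤ.+-identityʳ _))
  minimal : ∀ l → l Nat.< 1 → ¬ Σ (Fin l → Fin n → ℤ) λ gs → GeneratedBy P gs
  minimal zero    _ (_ , _ , span₀) = eᵥ≢0 (proj₂ (span₀ e Pe) v)
  minimal (suc _) (Nat.s≤s ())

module _ {n} (H : EdgeLabeledGraph n) where

  isSpline : ∀ f → (∀ v → m H v ∣ f v) →
    (∀ u v → adj H u v ≡ true → f u ≡ f v mod r H u v) → IsSpline H f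
  isSpline f m∣f f≡f = (λ v → ∣⇒∣ᵤ (m∣f v)) , (λ u v e → ∣⇒∣ᵤ (∣-difference (f≡f u v e)))

  spline-vertex : ∀ f → IsSpline H f → ∀ v → m H v ∣ f v
  spline-vertex f (m∣f , _) v = ∣ᵤ⇒∣ (m∣f v)

  spline-edge : ∀ f → IsSpline H f → ∀ u v → adj H u v ≡ true → f u ≡ f v mod r H u v
  spline-edge f (_ , r∣f-f) u v e = mk≡mod (∣ᵤ⇒∣ (r∣f-f u v e))

  zeroV-isSpline : IsSpline H zeroV
  zeroV-isSpline = isSpline zeroV (λ v → ∣0 (m H v)) (λ u v _ → mod-refl 0ℤ)

  +V-isSpline : ∀ f g → IsSpline H f → IsSpline H g → IsSpline H (f +V g)
  +V-isSpline f g Sf Sg = isSpline (f +V g)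
    (λ v → ∣m∣n⇒∣m+n (spline-vertex f Sf v) (spline-vertex g Sg v))
    (λ u v e → mod-+ (spline-edge f Sf u v e) (spline-edge g Sg u v e))

  ·V-isSpline : ∀ c f → IsSpline H f → IsSpline H (c ·V f)
  ·V-isSpline c f Sf = isSpline (c ·V f)
    (λ v → ∣n⇒∣m*n c (spline-vertex f Sf v))
    (λ u v e → mod-* c (spline-edge f Sf u v e))

  ≐-isSpline : ∀ f g → f ≐ g → IsSpline H f → IsSpline H g
  ≐-isSpline f g f≐g Sf = isSpline g
    (λ v → subst (m H v ∣_) (f≐g v) (spline-vertex f Sf v))
    (λ u v e → subst₂ (λ p q → p ≡ q mod r H u v) (f≐g u) (f≐g v) (spline-edge f Sf u v e))

module _ {k : ℕ} (G : EdgeLabeledGraph (suc k)) where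
  private
    vₙ : Fin (suc k)
    vₙ = fromℕ k
    ι : Fin k → Fin (suc k)
    ι = inject₁
    G′ : EdgeLabeledGraph k
    G′ = reducedGraph G

  reduced-m-∣ : ∀ w {x} → m G (ι w) ∣ x →
    (nb G w ≡ true → gcd (m G vₙ) (r G (ι w) vₙ) ∣ x) → m G′ w ∣ x
  reduced-m-∣ w m∣x gcd∣x with nb G w
  ... | true  = lcm-least m∣x (gcd∣x refl)
  ... | false = m∣x

  m∣reduced-m : ∀ w → m G (ι w) ∣ m G′ w
  m∣reduced-m w with nb G w
  ... | true  = ∣lcmˡ (m G (ι w)) (gcd (m G vₙ) (r G (ι w) vₙ))
  ... | false = ∣-refl

  gcd∣reduced-m : ∀ w → nb G w ≡ true → gcd (m G vₙ) (r G (ι w) vₙ) ∣ m G′ w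
  gcd∣reduced-m w nbw rewrite nbw = ∣lcmʳ (m G (ι w)) (gcd (m G vₙ) (r G (ι w) vₙ))

  reduced-r-mod : ∀ u w {x y} → adj G′ u w ≡ true →
    (oldEdge G u w ≡ true → x ≡ y mod r G (ι u) (ι w)) →
    (newEdge G u w ≡ true → x ≡ y mod gcd (r G vₙ (ι u)) (r G vₙ (ι w))) →
    x ≡ y mod r G′ u w
  reduced-r-mod u w e old new with oldEdge G u w | newEdge G u w
  ... | true  | true  = mod-lcm (old refl) (new refl)
  ... | true  | false = old refl
  ... | false | true  = new refl
  reduced-r-mod u w () _ _ | false | false

  r∣reduced-r : ∀ u w → oldEdge G u w ≡ true → r G (ι u) (ι w) ∣ r G′ u w
  r∣reduced-r u w old rewrite old with newEdge G u w
  ... | true  = ∣lcmˡ (r G (ι u) (ι w)) (gcd (r G vₙ (ι u)) (r G vₙ (ι w)))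
  ... | false = ∣-refl

  gcd∣reduced-r : ∀ u w → newEdge G u w ≡ true → gcd (r G vₙ (ι u)) (r G vₙ (ι w)) ∣ r G′ u w
  gcd∣reduced-r u w new rewrite new with oldEdge G u w
  ... | true  = ∣lcmʳ (r G (ι u) (ι w)) (gcd (r G vₙ (ι u)) (r G vₙ (ι w)))
  ... | false = ∣-refl

  oldEdge⇒adj : ∀ {u w} → oldEdge G u w ≡ true → adj G′ u w ≡ true
  oldEdge⇒adj {u} {w} old = trans (cong (_∨ newEdge G u w) old) (∨-zeroˡ (newEdge G u w))

  newEdge⇒adj : ∀ {u w} → newEdge G u w ≡ true → adj G′ u w ≡ true
  newEdge⇒adj {u} {w} new = trans (cong (oldEdge G u w ∨_) new) (∨-zeroʳ (oldEdge G u w))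

  newEdge⇒nb : ∀ u w → newEdge G u w ≡ true → nb G u ≡ true × nb G w ≡ true
  newEdge⇒nb u w new with nb G u | nb G w
  ... | true  | true  = refl , refl
  newEdge⇒nb u w () | false | _
  newEdge⇒nb u w () | true  | false

  nb⇒newEdge : ∀ {u w} → nb G u ≡ true → nb G w ≡ true → u ≢ w → newEdge G u w ≡ true
  nb⇒newEdge {u} {w} nbu nbw u≢w rewrite nbu | nbw with u ≟ w
  ... | yes u≡w = ⊥-elim (u≢w u≡w)
  ... | no _    = refl

  r-last : Fin k → ℤ
  r-last w = if nb G w then r G vₙ (ι w) else 1ℤ

  r-last-∣ : ∀ w {x} → (nb G w ≡ true → r G vₙ (ι w) ∣ x) → r-last w ∣ x
  r-last-∣ w r∣x with nb G w
  ... | true  = r∣x refl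
  ... | false = 1∣ _

  r∣r-last : ∀ w → nb G w ≡ true → r G vₙ (ι w) ∣ r-last w
  r∣r-last w nbw rewrite nbw = ∣-refl

  mod-gcd-r-lastʳ : ∀ a w {x y} → (nb G w ≡ true → x ≡ y mod gcd a (r G vₙ (ι w))) →
    x ≡ y mod gcd a (r-last w)
  mod-gcd-r-lastʳ a w h with nb G w
  ... | true  = h refl
  ... | false = mod-weaken (gcd∣ʳ a 1ℤ) (mod-1 _ _)

  mod-gcd-r-lastˡ : ∀ a w {x y} → (nb G w ≡ true → x ≡ y mod gcd (r G vₙ (ι w)) a) →
    x ≡ y mod gcd (r-last w) a
  mod-gcd-r-lastˡ a w h with nb G w
  ... | true  = h refl
  ... | false = mod-weaken (gcd∣ˡ 1ℤ a) (mod-1 _ _)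

  Kernel : (Fin (suc k) → ℤ) → Set
  Kernel f = IsSpline G f × ψ G f ≐ zeroV

  kernel-isSubmodule : IsSubmodule Kernel
  kernel-isSubmodule =
    (zeroV-isSpline G , λ _ → refl) ,
    (λ f g (Sf , f≐0) (Sg , g≐0) → +V-isSpline G f g Sf Sg , λ w → cong₂ _+_ (f≐0 w) (g≐0 w)) ,
    (λ c f (Sf , f≐0) → ·V-isSpline G c f Sf , λ w → trans (cong (c *_) (f≐0 w)) (ℤ.*-zeroʳ c)) ,
    (λ f g f≐g (Sf , f≐0) → ≐-isSpline G f g f≐g Sf , λ w → trans (sym (f≐g (ι w))) (f≐0 w))

  kernel⇔flowUp : ∀ f → Kernel f ⇔ (IsFlowUp G vₙ f ⊎ f ≐ zeroV)
  kernel⇔flowUp f = mk⇔ to from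
    where
    to : Kernel f → IsFlowUp G vₙ f ⊎ f ≐ zeroV
    to (Sf , f≐0) with f vₙ ℤ.≟ 0ℤ
    ... | yes fₙ≡0 = inj₂ (≐-by-last f≐0 fₙ≡0)
    ... | no  fₙ≢0 = inj₁ (Sf , fₙ≢0 , below-fromℕ f≐0)
    from : IsFlowUp G vₙ f ⊎ f ≐ zeroV → Kernel f
    from (inj₁ (Sf , _ , below)) = Sf , λ w → below (ι w) (inject₁<fromℕ w)
    from (inj₂ f≐0) = ≐-isSpline G zeroV f (sym ∘ f≐0) (zeroV-isSpline G) , λ w → f≐0 (ι w)

  module _ (simple : IsSimple G) where

    adj-sym : ∀ {u v} → adj G u v ≡ true → adj G v u ≡ true
    adj-sym {u} {v} = trans (proj₁ simple v u)

    r-sym : ∀ {u v} → adj G u v ≡ true → r G u v ≡ r G v u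
    r-sym {u} {v} = proj₂ (proj₂ simple) u v

    no-loop : ∀ {v} → adj G v v ≢ true
    no-loop {v} e with trans (sym e) (proj₁ (proj₂ simple) v)
    ... | ()

    spline-edge-last : ∀ f → IsSpline G f → ∀ w → nb G w ≡ true →
      f (ι w) ≡ f vₙ mod r G vₙ (ι w)
    spline-edge-last f Sf w nbw =
      subst (f (ι w) ≡ f vₙ mod_) (r-sym nbw) (spline-edge G f Sf (ι w) vₙ nbw)

    ∷ʳ-isSpline : ∀ {g x} → m G vₙ ∣ x → (∀ w → x ≡ g w mod r-last w) →
      (∀ w → m G (ι w) ∣ g w) →
      (∀ u w → oldEdge G u w ≡ true → g u ≡ g w mod r G (ι u) (ι w)) →
      IsSpline G (g ∷ʳ x)
    ∷ʳ-isSpline {g} {x} m∣x x≡g m∣g g≡g = isSpline G (g ∷ʳ x) vertex edge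
      where
      vertex : ∀ v → m G v ∣ (g ∷ʳ x) v
      vertex v with view v
      ... | ‵fromℕ     rewrite ∷ʳ-fromℕ g x     = m∣x
      ... | ‵inject₁ w rewrite ∷ʳ-inject₁ g x w = m∣g w
      edge : ∀ u v → adj G u v ≡ true → (g ∷ʳ x) u ≡ (g ∷ʳ x) v mod r G u v
      edge u v e with view u | view v
      ... | ‵fromℕ     | ‵fromℕ     = ⊥-elim (no-loop e)
      ... | ‵fromℕ     | ‵inject₁ w rewrite ∷ʳ-fromℕ g x | ∷ʳ-inject₁ g x w =
        mod-weaken (r∣r-last w (adj-sym e)) (x≡g w)
      ... | ‵inject₁ w | ‵fromℕ     rewrite ∷ʳ-fromℕ g x | ∷ʳ-inject₁ g x w | r-sym e =
        mod-sym (mod-weaken (r∣r-last w e) (x≡g w))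
      ... | ‵inject₁ u | ‵inject₁ w rewrite ∷ʳ-inject₁ g x u | ∷ʳ-inject₁ g x w = g≡g u w e

    ψ-isSpline : ∀ f → IsSpline G f → IsSpline G′ (ψ G f)
    ψ-isSpline f Sf = isSpline G′ (ψ G f) vertex edge
      where
      vertex : ∀ w → m G′ w ∣ f (ι w)
      vertex w = reduced-m-∣ w (spline-vertex G f Sf (ι w)) λ nbw → ≡0-mod⇒∣ (mod-trans
        (mod-weaken (gcd∣ʳ (m G vₙ) (r G (ι w) vₙ)) (spline-edge G f Sf (ι w) vₙ nbw))
        (mod-weaken (gcd∣ˡ (m G vₙ) (r G (ι w) vₙ)) (∣⇒≡0-mod (spline-vertex G f Sf vₙ))))
      edge : ∀ u w → adj G′ u w ≡ true → f (ι u) ≡ f (ι w) mod r G′ u w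
      edge u w e = reduced-r-mod u w e (spline-edge G f Sf (ι u) (ι w)) λ new →
        let nbu , nbw = newEdge⇒nb u w new in mod-trans
          (mod-weaken (gcd∣ˡ (r G vₙ (ι u)) (r G vₙ (ι w))) (spline-edge-last f Sf u nbu))
          (mod-sym (mod-weaken (gcd∣ʳ (r G vₙ (ι u)) (r G vₙ (ι w))) (spline-edge-last f Sf w nbw)))

    ψ-surjective : ∀ g → IsSpline G′ g → ∃ λ f → IsSpline G f × ψ G f ≐ g
    ψ-surjective g Sg = g ∷ʳ x , ∷ʳ-isSpline (≡0-mod⇒∣ x≡0) x≡g m∣g g≡g , ∷ʳ-inject₁ g x
      where
      compat₀ : ∀ w → 0ℤ ≡ g w mod gcd (m G vₙ) (r-last w)
      compat₀ w = mod-gcd-r-lastʳ (m G vₙ) w λ nbw → mod-sym (∣⇒≡0-mod (∣-trans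
        (subst (λ ρ → gcd (m G vₙ) ρ ∣ m G′ w) (r-sym nbw) (gcd∣reduced-m w nbw))
        (spline-vertex G′ g Sg w)))
      compat : ∀ u w → g u ≡ g w mod gcd (r-last u) (r-last w)
      compat u w with u ≟ w
      ... | yes refl = mod-refl (g u)
      ... | no u≢w   =
        mod-gcd-r-lastʳ (r-last u) w λ nbw → mod-gcd-r-lastˡ (r G vₙ (ι w)) u λ nbu →
        let new = nb⇒newEdge nbu nbw u≢w in
        mod-weaken (gcd∣reduced-r u w new) (spline-edge G′ g Sg u w (newEdge⇒adj new))
      solution : ∃ λ x → x ≡ 0ℤ mod m G vₙ × (∀ w → x ≡ g w mod r-last w)
      solution = crt (m G vₙ) 0ℤ r-last g compat₀ compat
      x : ℤ
      x = proj₁ solution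
      x≡0 : x ≡ 0ℤ mod m G vₙ
      x≡0 = proj₁ (proj₂ solution)
      x≡g : ∀ w → x ≡ g w mod r-last w
      x≡g = proj₂ (proj₂ solution)
      m∣g : ∀ w → m G (ι w) ∣ g w
      m∣g w = ∣-trans (m∣reduced-m w) (spline-vertex G′ g Sg w)
      g≡g : ∀ u w → oldEdge G u w ≡ true → g u ≡ g w mod r G (ι u) (ι w)
      g≡g u w old = mod-weaken (r∣reduced-r u w old) (spline-edge G′ g Sg u w (oldEdge⇒adj old))

    L : ℤ
    L = lcm (m G vₙ) (lcmᶠ r-last)

    generator : Fin (suc k) → ℤ
    generator = zeroV ∷ʳ L

    generator∈kernel : Kernel generator
    generator∈kernel =
      ∷ʳ-isSpline (∣lcmˡ (m G vₙ) (lcmᶠ r-last))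
        (λ w → ∣⇒≡0-mod (∣-trans (∣lcmᶠ r-last w) (∣lcmʳ (m G vₙ) (lcmᶠ r-last))))
        (λ w → ∣0 (m G (ι w)))
        (λ u w _ → mod-refl 0ℤ) ,
      ∷ʳ-inject₁ zeroV L

    L∣kernel : ∀ f → Kernel f → L ∣ f vₙ
    L∣kernel f (Sf , f≐0) =
      lcm-least (spline-vertex G f Sf vₙ) (lcmᶠ-least λ w → r-last-∣ w λ nbw →
        ≡0-mod⇒∣ (subst (f vₙ ≡_mod r G vₙ (ι w)) (f≐0 w) (mod-sym (spline-edge-last f Sf w nbw))))

    kernel-cyclic : ∀ f → Kernel f → ∃ λ q → f ≐ (q ·V generator)
    kernel-cyclic f Kf@(_ , f≐0) with L∣kernel f Kf
    ... | divides q fₙ≡qL = q , ≐-by-last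
      (λ w → trans (f≐0 w) (sym (trans (cong (q *_) (∷ʳ-inject₁ zeroV L w)) (ℤ.*-zeroʳ q))))
      (trans fₙ≡qL (cong (q *_) (sym (∷ʳ-fromℕ {k} zeroV L))))

    r-last≢0 : NonzeroLabels G → ∀ w → r-last w ≢ 0ℤ
    r-last≢0 (_ , r≢0) w with nb G w in nbw
    ... | true  = r≢0 vₙ (ι w) (adj-sym nbw)
    ... | false = λ ()

    kernel-hasRank1 : NonzeroLabels G → HasRank Kernel 1
    kernel-hasRank1 nonzero = cyclic⇒hasRank1 vₙ generator∈kernel kernel-cyclic
      λ generatorₙ≡0 → L≢0 (trans (sym (∷ʳ-fromℕ {k} zeroV L)) generatorₙ≡0)
      where
      L≢0 : L ≢ 0ℤ
      L≢0 = lcm≢0 (proj₁ nonzero vₙ) (lcmᶠ≢0 (r-last≢0 nonzero))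

theorem4p4 : (k : ℕ) (G : EdgeLabeledGraph (suc k)) →
    IsSimple G → IsConnected G → NonzeroLabels G →
    -- ψ is well defined: it maps splines on G to splines on G_red
    (∀ f → IsSpline G f → IsSpline (reducedGraph G) (ψ G f)) ×
    -- ψ is ℤ-linear
    (∀ f g → ψ G (f +V g) ≐ (ψ G f +V ψ G g)) ×
    (∀ (c : ℤ) f → ψ G (c ·V f) ≐ (c ·V ψ G f)) ×
    -- ψ is surjective onto the splines of G_red
    (∀ g → IsSpline (reducedGraph G) g →
       Σ (Fin (suc k) → ℤ) λ f → IsSpline G f × ψ G f ≐ g) ×
    -- the kernel is F_n ∪ {0}
    (∀ f → (IsSpline G f × ψ G f ≐ zeroV) ⇔
           (IsFlowUp G (fromℕ k) f ⊎ f ≐ zeroV)) ×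
    -- the kernel is a submodule of rank 1
    IsSubmodule (λ f → IsSpline G f × ψ G f ≐ zeroV) ×
    HasRank (λ f → IsSpline G f × ψ G f ≐ zeroV) 1
theorem4p4 k G simple _ nonzero =
  ψ-isSpline G simple ,
  (λ f g w → refl) ,
  (λ c f w → refl) ,
  ψ-surjective G simple ,
  kernel⇔flowUp G ,
  kernel-isSubmodule G ,
  kernel-hasRank1 G simple nonzero
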